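{- Let $\Delta$ be a finite simplicial complex and let $\tau:\Delta\to\Delta$ be an involution of $\Delta$. Suppose that the fixed point set $\Delta^{\tau}=\{\sigma\in\Delta:\tau(\sigma)=\sigma\}$ is itself a simplicial complex (equivalently, no simplex of $\Delta$ fixed by $\tau$ contains two distinct vertices that are interchanged by $\tau$). Then $g(\Delta)=g(\Delta^{\tau})$, where $g$ denotes the nim-value in the game of subset take-away.
   Context: A (finite) simplicial complex $\Delta$ on a finite vertex set $V$ is a collection of nonempty subsets of $V$ such that whenever $\sigma\in\Delta$ and $\emptyset\neq\varphi\subseteq\sigma$, also $\varphi\in\Delta$. Subset take-away on $\Delta$ is the impartial two-player game in which players alternate; a move consists of choosing some $\sigma$ in the current complex and deleting $\sigma$ together with every element of the current complex that contains $\sigma$; the resulting position is again a simplicial complex. The player who makes the last move wins. The nim-value $g$ of a position is defined recursively: $g(\emptyset)=0$, and $g(\Delta)$ is the minimal nonnegative integer not equal to $g$ of any position reachable from $\Delta$ in one move. An involution of $\Delta$ is a map $\tau:\Delta\to\Delta$ such that (1) $\tau$ restricted to the vertices (singletons) of $\Delta$ is a permutation with $\tau^2(A)=A$ for every vertex $A$, and (2) for $\sigma=\{\sigma_1,\dots,\sigma_k\}$, one has $\sigma\in\Delta$ if and only if $\tau(\sigma)=\{\tau(\sigma_1),\dots,\tau(\sigma_k)\}\in\Delta$ (here vertices are identified with elements of $V$). -}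

module Defs where

open import Data.Bool using (Bool; true; false; _∧_; not; if_then_else_)
import Data.Bool.Properties as BoolP
open import Data.Nat using (ℕ; zero; suc)
import Data.Nat.Properties as ℕP
open import Data.Fin using (Fin)
import Data.Fin.Properties as FinP
open import Data.Fin.Subset using (Subset; _∈_; _⊆_; Nonempty; ⁅_⁆; inside; outside)
open import Data.Fin.Subset.Properties using (_∈?_; _⊆?_)
open import Data.List using (List; []; _∷_; _++_; map; filter; length)
open import Data.List.Membership.DecPropositional ℕP._≟_ using () renaming (_∈?_ to _∈ℕ?_)
open import Data.Vec using (Vec; []; _∷_; tabulate)
import Data.Vec.Properties as VecP
open import Data.Product using (_×_; _,_)
open import Relation.Nullary using (Dec; yes; no; ¬_)
open import Relation.Nullary.Decidable using (⌊_⌋; _×-dec_)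
open import Relation.Binary.PropositionalEquality using (_≡_)

Complex : ℕ → Set
Complex n = Subset n → Bool

_∈Δ_ : ∀ {n} → Subset n → Complex n → Set
σ ∈Δ Δ = Δ σ ≡ true

IsSimplicialComplex : ∀ {n} → Complex n → Set
IsSimplicialComplex {n} Δ =
  (∀ (σ : Subset n) → σ ∈Δ Δ → Nonempty σ) ×
  (∀ (σ φ : Subset n) → σ ∈Δ Δ → Nonempty φ → φ ⊆ σ → φ ∈Δ Δ)

allSubsets : ∀ n → List (Subset n)
allSubsets zero = [] ∷ []
allSubsets (suc n) = map (outside ∷_) (allSubsets n) ++ map (inside ∷_) (allSubsets n)

simplices : ∀ {n} → Complex n → List (Subset n)
simplices {n} Δ = filter (λ σ → BoolP._≟_ (Δ σ) true) (allSubsets n)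

move : ∀ {n} → Complex n → Subset n → Complex n
move Δ σ ρ = Δ ρ ∧ not ⌊ σ ⊆? ρ ⌋

mexFrom : ℕ → ℕ → List ℕ → ℕ
mexFrom zero k l = k
mexFrom (suc f) k l = if ⌊ k ∈ℕ? l ⌋ then mexFrom f (suc k) l else k

mex : List ℕ → ℕ
mex l = mexFrom (length l) 0 l

-- nim-value with fuel; every move removes at least one simplex, so fuel equal
-- to the number of simplices suffices (g(∅) = 0).
nimFuel : ∀ {n} → ℕ → Complex n → ℕ
nimFuel zero Δ = 0
nimFuel (suc f) Δ = mex (map (λ σ → nimFuel f (move Δ σ)) (simplices Δ))

nimValue : ∀ {n} → Complex n → ℕ
nimValue Δ = nimFuel (length (simplices Δ)) Δ

image : ∀ {n} → (Fin n → Fin n) → Subset n → Subset n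
image τ σ = tabulate (λ j →
  ⌊ FinP.any? (λ i → (i ∈? σ) ×-dec (τ i FinP.≟ j)) ⌋)

IsVertex : ∀ {n} → Complex n → Fin n → Set
IsVertex Δ a = ⁅ a ⁆ ∈Δ Δ

-- τ is an involution of Δ: an involutive permutation of the vertices of Δ
-- (its values outside the vertices are irrelevant) such that, for every
-- nonempty set σ of vertices, σ ∈ Δ iff τ(σ) ∈ Δ.
IsInvolution : ∀ {n} → Complex n → (Fin n → Fin n) → Set
IsInvolution {n} Δ τ =
  (∀ a → IsVertex Δ a → IsVertex Δ (τ a)) ×
  (∀ a → IsVertex Δ a → τ (τ a) ≡ a) ×
  (∀ (σ : Subset n) → Nonempty σ → (∀ a → a ∈ σ → IsVertex Δ a) →
     (σ ∈Δ Δ → image τ σ ∈Δ Δ) × (image τ σ ∈Δ Δ → σ ∈Δ Δ))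

fixedSet : ∀ {n} → Complex n → (Fin n → Fin n) → Complex n
fixedSet Δ τ σ = Δ σ ∧ ⌊ VecP.≡-dec BoolP._≟_ (image τ σ) σ ⌋

-- Induction on the number of simplices, comparing the options of Δ with those of Δ^τ.
-- A move σ with τ(σ) = σ commutes with passing to fixed sets, so it has the same value
-- in Δ and in Δ^τ; thus the options of Δ^τ are options of Δ. A move σ with τ(σ) ≠ σ is
-- answered by τ(σ): no fixed simplex contains σ or τ(σ) (this is where Δ^τ being a complex
-- is used), so after both moves the fixed set is still Δ^τ, and by induction the position
-- has value g(Δ^τ); hence the move σ itself cannot lead to value g(Δ^τ). So g(Δ^τ) is not
-- an option of Δ, and g(Δ) = g(Δ^τ).
module Submission where

open import Algebra.Bundles using (CommutativeMonoid)
open import Data.Bool using (true; false; _∧_; not)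
import Data.Bool.Properties as BoolP
open import Algebra.Properties.CommutativeSemigroup
  (CommutativeMonoid.commutativeSemigroup BoolP.∧-commutativeMonoid) using (xy∙z≈xz∙y)
open import Data.Fin as Fin using (Fin; toℕ)
import Data.Fin.Properties as FinP
open import Data.Fin.Subset using (Subset; _∈_; _⊆_; outside; inside; ⁅_⁆)
open import Data.Fin.Subset.Properties using (_⊆?_; ⊆-antisym; x∈⁅x⁆; x∈⁅y⁆⇒x≡y)
open import Data.List using (List; []; map; length; lookup)
open import Data.List.Properties using (filter-≐; map-cong; map-cong-local)
open import Data.List.Membership.Propositional using () renaming (_∈_ to _∈ₗ_; _∉_ to _∉ₗ_)
open import Data.List.Membership.Propositional.Properties
  using (∈-map⁺; ∈-map⁻; ∈-filter⁺; ∈-filter⁻; ∈-++⁺ˡ; ∈-++⁺ʳ)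
import Data.List.Relation.Unary.All as All
open import Data.List.Relation.Unary.Any using (here; index)
open import Data.List.Relation.Unary.Any.Properties using (lookup-index)
open import Data.List.Relation.Binary.Pointwise using (Pointwise-≡⇒≡)
open import Data.List.Relation.Binary.Sublist.Propositional using (⊆-refl) renaming (_⊆_ to _⊑_)
open import Data.List.Relation.Binary.Sublist.Heterogeneous.Properties
  using (⊆-filter-Sublist; length-mono-≤; toPointwise)
open import Data.Nat using (ℕ; zero; suc; _+_; _≤_; _<_)
open import Data.Nat.Induction using (<-wellFounded)
import Data.Nat.Properties as ℕP
open import Data.List.Membership.DecPropositional ℕP._≟_ using () renaming (_∈?_ to _∈ℕ?_)
open import Data.Product using (_×_; _,_; proj₁; proj₂; ∃; ∃₂)
open import Data.Sum using (inj₁; inj₂)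
open import Data.Vec using ([]; _∷_)
import Data.Vec.Properties as VecP
open import Function using (_∘_; _on_; case_of_)
open import Induction.WellFounded using (Acc; acc)
import Relation.Binary.Construct.On as On
open import Relation.Binary.Definitions using (tri<; tri≈; tri>)
open import Relation.Binary.PropositionalEquality
  using (_≡_; _≢_; _≗_; refl; sym; trans; cong; cong₂; subst; module ≡-Reasoning)
open import Relation.Nullary using (Dec; yes; no; ¬_; contradiction)
open import Relation.Nullary.Decidable using (⌊_⌋; isYes≗does; dec-true; dec-false)

open import Defs

module _ {p} {P : Set p} where

  ⌊⌋-true⁻ : (p? : Dec P) → ⌊ p? ⌋ ≡ true → P
  ⌊⌋-true⁻ (yes p) _ = p

  ⌊⌋-true : (p? : Dec P) → P → ⌊ p? ⌋ ≡ true
  ⌊⌋-true p? p = trans (isYes≗does p?) (dec-true p? p)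

  ⌊⌋-false : (p? : Dec P) → ¬ P → ⌊ p? ⌋ ≡ false
  ⌊⌋-false p? ¬p = trans (isYes≗does p?) (dec-false p? ¬p)

private
  variable
    n : ℕ
    Δ Δ₁ Δ₂ : Complex n
    σ ρ : Subset n

∈-allSubsets : ∀ {n} (σ : Subset n) → σ ∈ₗ allSubsets n
∈-allSubsets [] = here refl
∈-allSubsets (false ∷ σ) = ∈-++⁺ˡ (∈-map⁺ (outside ∷_) (∈-allSubsets σ))
∈-allSubsets {suc n} (true ∷ σ) =
  ∈-++⁺ʳ (map (outside ∷_) (allSubsets n)) (∈-map⁺ (inside ∷_) (∈-allSubsets σ))

size : Complex n → ℕ
size Δ = length (simplices Δ)

∈-simplices⁺ : σ ∈Δ Δ → σ ∈ₗ simplices Δ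
∈-simplices⁺ {σ = σ} {Δ = Δ} = ∈-filter⁺ (λ ρ → Δ ρ BoolP.≟ true) (∈-allSubsets σ)

∈-simplices⁻ : σ ∈ₗ simplices Δ → σ ∈Δ Δ
∈-simplices⁻ {n} {Δ = Δ} = proj₂ ∘ ∈-filter⁻ (λ σ → Δ σ BoolP.≟ true) {xs = allSubsets n}

simplices-cong : Δ₁ ≗ Δ₂ → simplices Δ₁ ≡ simplices Δ₂
simplices-cong {n} {Δ₁} {Δ₂} e = filter-≐ (λ σ → Δ₁ σ BoolP.≟ true) (λ σ → Δ₂ σ BoolP.≟ true)
  ((λ {σ} h → trans (sym (e σ)) h) , (λ {σ} h → trans (e σ) h)) (allSubsets n)

move-cong : Δ₁ ≗ Δ₂ → ∀ σ → move Δ₁ σ ≗ move Δ₂ σ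
move-cong e σ ρ = cong (_∧ not ⌊ σ ⊆? ρ ⌋) (e ρ)

∈-move⁻ : ρ ∈Δ move Δ σ → ρ ∈Δ Δ × ¬ σ ⊆ ρ
∈-move⁻ {ρ = ρ} {Δ = Δ} {σ = σ} h with Δ ρ | σ ⊆? ρ
... | true  | no σ⊈ρ = refl , σ⊈ρ
... | true  | yes _ with () ← h
... | false | _     with () ← h

∈-move⁺ : ρ ∈Δ Δ → ¬ σ ⊆ ρ → ρ ∈Δ move Δ σ
∈-move⁺ {ρ = ρ} {σ = σ} ρ∈Δ σ⊈ρ = cong₂ _∧_ ρ∈Δ (cong not (⌊⌋-false (σ ⊆? ρ) σ⊈ρ))

∉-move : (Δ : Complex n) (σ : Subset n) → ¬ σ ∈Δ move Δ σ
∉-move Δ σ h = proj₂ (∈-move⁻ {Δ = Δ} {σ = σ} h) (λ x → x)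

move-inert : (∀ {ρ} → ρ ∈Δ Δ → ¬ σ ⊆ ρ) → move Δ σ ≗ Δ
move-inert {Δ = Δ} {σ = σ} σ⊈ ρ with Δ ρ in ρ∈Δ
... | false = refl
... | true  = cong not (⌊⌋-false (σ ⊆? ρ) (σ⊈ ρ∈Δ))

size-move : σ ∈Δ Δ → size (move Δ σ) < size Δ
size-move {n} {σ = σ} {Δ = Δ} σ∈Δ = ℕP.≤∧≢⇒< (length-mono-≤ sublist) λ same-size →
  ∉-move Δ σ (∈-simplices⁻ {Δ = move Δ σ} (subst (σ ∈ₗ_)
    (sym (Pointwise-≡⇒≡ (toPointwise same-size sublist))) (∈-simplices⁺ {Δ = Δ} σ∈Δ)))
  where
  sublist : simplices (move Δ σ) ⊑ simplices Δ
  sublist = ⊆-filter-Sublist (λ ρ → move Δ σ ρ BoolP.≟ true) (λ ρ → Δ ρ BoolP.≟ true)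
    (λ { {ρ} refl → proj₁ ∘ ∈-move⁻ {ρ = ρ} {Δ = Δ} {σ = σ} }) (⊆-refl {x = allSubsets n})

Covers : List ℕ → ℕ → Set
Covers l k = ∀ {j} → j < k → j ∈ₗ l

IsMex : List ℕ → ℕ → Set
IsMex l m = m ∉ₗ l × Covers l m

covers-suc : ∀ {l k} → Covers l k → k ∈ₗ l → Covers l (suc k)
covers-suc covers k∈l j<1+k with ℕP.m<1+n⇒m<n∨m≡n j<1+k
... | inj₁ j<k  = covers j<k
... | inj₂ refl = k∈l

covers⇒≤length : ∀ {l k} → Covers l k → k ≤ length l
covers⇒≤length {l} {k} covers = ℕP.≮⇒≥ λ ∣l∣<k → collision (FinP.pigeonhole ∣l∣<k position)
  where
  open ≡-Reasoning
  position : Fin k → Fin (length l)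
  position i = index (covers (FinP.toℕ<n i))
  collision : ¬ ∃₂ λ i j → i Fin.< j × position i ≡ position j
  collision (i , j , i<j , same-position) = ℕP.<⇒≢ i<j (begin
    toℕ i                 ≡⟨ lookup-index (covers (FinP.toℕ<n i)) ⟩
    lookup l (position i) ≡⟨ cong (lookup l) same-position ⟩
    lookup l (position j) ≡⟨ lookup-index (covers (FinP.toℕ<n j)) ⟨
    toℕ j                 ∎)

mexFrom-isMex : ∀ {l} fuel k → Covers l k → k + fuel ≡ length l → IsMex l (mexFrom fuel k l)
mexFrom-isMex {l} zero k covers k≡∣l∣ = k∉l , covers
  where
  k∉l : k ∉ₗ l
  k∉l k∈l = ℕP.<-irrefl (trans (sym (ℕP.+-identityʳ k)) k≡∣l∣)
    (covers⇒≤length (covers-suc covers k∈l))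
mexFrom-isMex {l} (suc fuel) k covers k+fuel≡∣l∣ with k ∈ℕ? l
... | yes k∈l = mexFrom-isMex fuel (suc k) (covers-suc covers k∈l)
                  (trans (sym (ℕP.+-suc k fuel)) k+fuel≡∣l∣)
... | no k∉l = k∉l , covers

mex-isMex : ∀ l → IsMex l (mex l)
mex-isMex l = mexFrom-isMex (length l) 0 (λ ()) refl

mex-unique : ∀ {l m} → IsMex l m → mex l ≡ m
mex-unique {l} {m} (m∉l , below-m) with ℕP.<-cmp (mex l) m
... | tri< mex<m _ _ = contradiction (below-m mex<m) (proj₁ (mex-isMex l))
... | tri≈ _ mex≡m _ = mex≡m
... | tri> _ _ m<mex = contradiction (proj₂ (mex-isMex l) m<mex) m∉l

mex-extend : ∀ {A B} → (∀ {x} → x ∈ₗ A → x ∈ₗ B) → mex A ∉ₗ B → mex B ≡ mex A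
mex-extend {A} A⊆B mexA∉B = mex-unique (mexA∉B , A⊆B ∘ proj₂ (mex-isMex A))

options : Complex n → List ℕ
options Δ = map (nimValue ∘ move Δ) (simplices Δ)

∈-options : σ ∈Δ Δ → nimValue (move Δ σ) ∈ₗ options Δ
∈-options {Δ = Δ} σ∈Δ = ∈-map⁺ (nimValue ∘ move Δ) (∈-simplices⁺ {Δ = Δ} σ∈Δ)

∈-options⁻ : ∀ {x} → x ∈ₗ options Δ → ∃ λ σ → σ ∈Δ Δ × x ≡ nimValue (move Δ σ)
∈-options⁻ {Δ = Δ} x∈ with σ , σ∈ , x≡ ← ∈-map⁻ (nimValue ∘ move Δ) x∈ =
  σ , ∈-simplices⁻ {Δ = Δ} σ∈ , x≡

nimFuel-cong : ∀ fuel → Δ₁ ≗ Δ₂ → nimFuel fuel Δ₁ ≡ nimFuel fuel Δ₂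
nimFuel-cong zero e = refl
nimFuel-cong {Δ₁ = Δ₁} {Δ₂} (suc fuel) e = cong mex (begin
  map (nimFuel fuel ∘ move Δ₁) (simplices Δ₁) ≡⟨ cong (map _) (simplices-cong e) ⟩
  map (nimFuel fuel ∘ move Δ₁) (simplices Δ₂) ≡⟨ map-cong (λ σ → nimFuel-cong fuel (move-cong e σ)) _ ⟩
  map (nimFuel fuel ∘ move Δ₂) (simplices Δ₂) ∎)
  where open ≡-Reasoning

nimValue-cong : Δ₁ ≗ Δ₂ → nimValue Δ₁ ≡ nimValue Δ₂
nimValue-cong {Δ₁ = Δ₁} {Δ₂} e =
  trans (cong (λ fuel → nimFuel fuel Δ₁) (cong length (simplices-cong e))) (nimFuel-cong (size Δ₂) e)

nimFuel-empty : ∀ fuel → size Δ ≡ 0 → nimFuel fuel Δ ≡ 0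
nimFuel-empty zero _ = refl
nimFuel-empty {Δ = Δ} (suc fuel) size≡0 with simplices Δ
... | [] = refl

nimFuel-stable : ∀ f f′ → size Δ ≤ f → size Δ ≤ f′ → nimFuel f Δ ≡ nimFuel f′ Δ
nimFuel-stable {Δ = Δ} zero f′ size≤0 _ = sym (nimFuel-empty {Δ = Δ} f′ (ℕP.n≤0⇒n≡0 size≤0))
nimFuel-stable {Δ = Δ} (suc f) zero _ size≤0 = nimFuel-empty {Δ = Δ} (suc f) (ℕP.n≤0⇒n≡0 size≤0)
nimFuel-stable {Δ = Δ} (suc f) (suc f′) size≤1+f size≤1+f′ = cong mex (map-cong-local
  (All.tabulate λ {σ} σ∈ → let move< = size-move {Δ = Δ} (∈-simplices⁻ {Δ = Δ} σ∈) in
    nimFuel-stable {Δ = move Δ σ} f f′ (ℕP.≤-pred (ℕP.≤-trans move< size≤1+f))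
                                       (ℕP.≤-pred (ℕP.≤-trans move< size≤1+f′))))

nimValue-options : (Δ : Complex n) → nimValue Δ ≡ mex (options Δ)
nimValue-options Δ = trans (nimFuel-stable {Δ = Δ} (size Δ) (suc (size Δ)) ℕP.≤-refl (ℕP.n≤1+n _))
  (cong mex (map-cong-local (All.tabulate λ {σ} σ∈ →
    nimFuel-stable {Δ = move Δ σ} (size Δ) (size (move Δ σ))
      (ℕP.<⇒≤ (size-move {Δ = Δ} (∈-simplices⁻ {Δ = Δ} σ∈))) ℕP.≤-refl)))

nimValue-move≢ : σ ∈Δ Δ → nimValue (move Δ σ) ≢ nimValue Δ
nimValue-move≢ {Δ = Δ} σ∈Δ same = proj₁ (mex-isMex (options Δ))
  (subst (_∈ₗ options Δ) (trans same (nimValue-options Δ)) (∈-options σ∈Δ))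

module _ (τ : Fin n → Fin n) where

  ∈-image⁺ : ∀ {i} → i ∈ σ → τ i ∈ image τ σ
  ∈-image⁺ {σ = σ} {i} i∈σ = VecP.lookup⇒[]= (τ i) (image τ σ)
    (trans (VecP.lookup∘tabulate _ (τ i))
           (⌊⌋-true (FinP.any? _) (i , i∈σ , refl)))

  ∈-image⁻ : ∀ {j} → j ∈ image τ σ → ∃ λ i → i ∈ σ × τ i ≡ j
  ∈-image⁻ {σ = σ} {j} j∈τσ = ⌊⌋-true⁻ (FinP.any? _)
    (trans (sym (VecP.lookup∘tabulate _ j)) (VecP.[]=⇒lookup j∈τσ))

  image-mono : σ ⊆ ρ → image τ σ ⊆ image τ ρ
  image-mono σ⊆ρ j∈τσ with ∈-image⁻ j∈τσ
  ... | i , i∈σ , refl = ∈-image⁺ (σ⊆ρ i∈σ)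

  image-image : (∀ {a} → a ∈ σ → τ (τ a) ≡ a) → image τ (image τ σ) ≡ σ
  image-image {σ = σ} ττ≡id = ⊆-antisym
    (λ j∈ττσ → case ∈-image⁻ j∈ττσ of λ { (i , i∈τσ , refl) →
               case ∈-image⁻ i∈τσ of λ { (a , a∈σ , refl) → subst (_∈ σ) (sym (ττ≡id a∈σ)) a∈σ } })
    (λ {a} a∈σ → subst (_∈ image τ (image τ σ)) (ττ≡id a∈σ) (∈-image⁺ (∈-image⁺ a∈σ)))

  ⊆-image⇒image-⊆ : image τ (image τ ρ) ≡ ρ → σ ⊆ image τ ρ → image τ σ ⊆ ρ
  ⊆-image⇒image-⊆ {ρ = ρ} {σ = σ} ττρ≡ρ σ⊆τρ = subst (image τ σ ⊆_) ττρ≡ρ (image-mono σ⊆τρ)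

  IsFixed : Subset n → Set
  IsFixed σ = image τ σ ≡ σ

  fixed? : (σ : Subset n) → Dec (IsFixed σ)
  fixed? σ = VecP.≡-dec BoolP._≟_ (image τ σ) σ

  ∈-fixedSet⁺ : σ ∈Δ Δ → IsFixed σ → σ ∈Δ fixedSet Δ τ
  ∈-fixedSet⁺ σ∈Δ σ-fixed = cong₂ _∧_ σ∈Δ (⌊⌋-true (fixed? _) σ-fixed)

  ∈-fixedSet⁻ : σ ∈Δ fixedSet Δ τ → σ ∈Δ Δ × IsFixed σ
  ∈-fixedSet⁻ {σ = σ} {Δ = Δ} h =
    BoolP.∧-conicalˡ (Δ σ) _ h , ⌊⌋-true⁻ (fixed? σ) (BoolP.∧-conicalʳ (Δ σ) _ h)

  fixedSet-move : (Δ : Complex n) (σ : Subset n) → fixedSet (move Δ σ) τ ≗ move (fixedSet Δ τ) σ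
  fixedSet-move Δ σ ρ = xy∙z≈xz∙y (Δ ρ) _ _

  -- What the induction needs of (Δ, τ); unlike IsInvolution, it survives a move by a
  -- fixed simplex and a pair of moves σ, τ(σ).
  record Invariant (Δ : Complex n) : Set where
    field
      image-closed     : σ ∈Δ Δ → image τ σ ∈Δ Δ
      image-involutive : σ ∈Δ Δ → image τ (image τ σ) ≡ σ
      face-of-fixed    : σ ∈Δ Δ → ρ ∈Δ Δ → IsFixed ρ → σ ⊆ ρ → IsFixed σ

  module _ (I : Invariant Δ) where
    open Invariant I

    Invariant-⊆ : (Δ′ : Complex n) → (∀ {ρ} → ρ ∈Δ Δ′ → ρ ∈Δ Δ) →
                  (∀ {ρ} → ρ ∈Δ Δ′ → image τ ρ ∈Δ Δ′) → Invariant Δ′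
    Invariant-⊆ _ Δ′⊆Δ Δ′-closed = record
      { image-closed     = Δ′-closed
      ; image-involutive = image-involutive ∘ Δ′⊆Δ
      ; face-of-fixed    = λ σ∈ ρ∈ → face-of-fixed (Δ′⊆Δ σ∈) (Δ′⊆Δ ρ∈)
      }

    ⊆-image⇒fixed : σ ∈Δ Δ → σ ⊆ image τ σ → IsFixed σ
    ⊆-image⇒fixed σ∈Δ σ⊆τσ = ⊆-antisym (⊆-image⇒image-⊆ (image-involutive σ∈Δ) σ⊆τσ) σ⊆τσ

    image-∈-move : σ ∈Δ Δ → ¬ IsFixed σ → image τ σ ∈Δ move Δ σ
    image-∈-move σ∈Δ σ-unfixed =
      ∈-move⁺ {Δ = Δ} (image-closed σ∈Δ) (σ-unfixed ∘ ⊆-image⇒fixed σ∈Δ)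

    Invariant-move-fixed : IsFixed σ → Invariant (move Δ σ)
    Invariant-move-fixed {σ = σ} σ-fixed = Invariant-⊆ (move Δ σ) (proj₁ ∘ ∈-move⁻ {Δ = Δ}) λ ρ∈ →
      let ρ∈Δ , σ⊈ρ = ∈-move⁻ {Δ = Δ} {σ = σ} ρ∈ in
      ∈-move⁺ {Δ = Δ} (image-closed ρ∈Δ) λ σ⊆τρ →
        σ⊈ρ (subst (_⊆ _) σ-fixed (⊆-image⇒image-⊆ (image-involutive ρ∈Δ) σ⊆τρ))

    Invariant-move-pair : σ ∈Δ Δ → Invariant (move (move Δ σ) (image τ σ))
    Invariant-move-pair {σ = σ} σ∈Δ =
      Invariant-⊆ (move (move Δ σ) (image τ σ))
        (proj₁ ∘ ∈-move⁻ {Δ = Δ} ∘ proj₁ ∘ ∈-move⁻ {Δ = move Δ σ}) λ ρ∈ →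
        let ρ∈Δσ , τσ⊈ρ = ∈-move⁻ {Δ = move Δ σ} {σ = image τ σ} ρ∈
            ρ∈Δ , σ⊈ρ = ∈-move⁻ {Δ = Δ} {σ = σ} ρ∈Δσ
            ττρ≡ρ = image-involutive ρ∈Δ
            τρ∈Δσ = ∈-move⁺ {Δ = Δ} (image-closed ρ∈Δ) (τσ⊈ρ ∘ ⊆-image⇒image-⊆ ττρ≡ρ) in
        ∈-move⁺ {Δ = move Δ σ} τρ∈Δσ λ τσ⊆τρ →
          σ⊈ρ (subst (_⊆ _) (image-involutive σ∈Δ) (⊆-image⇒image-⊆ ττρ≡ρ τσ⊆τρ))

    fixedSet-move-pair : σ ∈Δ Δ → ¬ IsFixed σ →
                         fixedSet (move (move Δ σ) (image τ σ)) τ ≗ fixedSet Δ τ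
    fixedSet-move-pair {σ = σ} σ∈Δ σ-unfixed ρ = begin
      fixedSet (move (move Δ σ) τσ) τ ρ ≡⟨ fixedSet-move (move Δ σ) τσ ρ ⟩
      move (fixedSet (move Δ σ) τ) τσ ρ ≡⟨ move-cong (fixedSet-move Δ σ) τσ ρ ⟩
      move (move Δᵗ σ) τσ ρ             ≡⟨ move-cong (move-inert {Δ = Δᵗ} σ-misses-fixed) τσ ρ ⟩
      move Δᵗ τσ ρ                      ≡⟨ move-inert {Δ = Δᵗ} τσ-misses-fixed ρ ⟩
      Δᵗ ρ                              ∎
      where
      open ≡-Reasoning
      τσ = image τ σ
      Δᵗ = fixedSet Δ τ
      σ-misses-fixed : ∀ {ρ} → ρ ∈Δ Δᵗ → ¬ σ ⊆ ρ
      σ-misses-fixed ρ∈ σ⊆ρ = let ρ∈Δ , ρ-fixed = ∈-fixedSet⁻ {Δ = Δ} ρ∈ in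
        σ-unfixed (face-of-fixed σ∈Δ ρ∈Δ ρ-fixed σ⊆ρ)
      τσ-misses-fixed : ∀ {ρ} → ρ ∈Δ Δᵗ → ¬ τσ ⊆ ρ
      τσ-misses-fixed ρ∈ τσ⊆ρ = let ρ∈Δ , ρ-fixed = ∈-fixedSet⁻ {Δ = Δ} ρ∈ in
        σ-unfixed (trans (sym (face-of-fixed (image-closed σ∈Δ) ρ∈Δ ρ-fixed τσ⊆ρ))
                         (image-involutive σ∈Δ))

    module _ (ih : ∀ {Δ′} → size Δ′ < size Δ → Invariant Δ′ →
                   nimValue Δ′ ≡ nimValue (fixedSet Δ′ τ)) where

      nimValue-move-fixed : σ ∈Δ Δ → IsFixed σ →
                            nimValue (move Δ σ) ≡ nimValue (move (fixedSet Δ τ) σ)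
      nimValue-move-fixed {σ = σ} σ∈Δ σ-fixed =
        trans (ih (size-move {Δ = Δ} σ∈Δ) (Invariant-move-fixed σ-fixed))
              (nimValue-cong (fixedSet-move Δ σ))

      nimValue-move-unfixed : σ ∈Δ Δ → ¬ IsFixed σ →
                              nimValue (move Δ σ) ≢ nimValue (fixedSet Δ τ)
      nimValue-move-unfixed {σ = σ} σ∈Δ σ-unfixed same =
        nimValue-move≢ {Δ = move Δ σ} τσ∈Δσ (begin
          nimValue Δσσ               ≡⟨ ih size< (Invariant-move-pair σ∈Δ) ⟩
          nimValue (fixedSet Δσσ τ)  ≡⟨ nimValue-cong (fixedSet-move-pair σ∈Δ σ-unfixed) ⟩
          nimValue (fixedSet Δ τ)    ≡⟨ same ⟨
          nimValue (move Δ σ)        ∎)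
        where
        open ≡-Reasoning
        Δσσ = move (move Δ σ) (image τ σ)
        τσ∈Δσ = image-∈-move σ∈Δ σ-unfixed
        size< = ℕP.<-trans (size-move {Δ = move Δ σ} τσ∈Δσ) (size-move {Δ = Δ} σ∈Δ)

      nimValue-move≢fixedSet : σ ∈Δ Δ → nimValue (move Δ σ) ≢ nimValue (fixedSet Δ τ)
      nimValue-move≢fixedSet {σ = σ} σ∈Δ with fixed? σ
      ... | yes σ-fixed = nimValue-move≢ {Δ = fixedSet Δ τ} (∈-fixedSet⁺ {Δ = Δ} σ∈Δ σ-fixed)
                          ∘ trans (sym (nimValue-move-fixed σ∈Δ σ-fixed))
      ... | no σ-unfixed = nimValue-move-unfixed σ∈Δ σ-unfixed

      nimValue-fixedSet-step : nimValue Δ ≡ nimValue (fixedSet Δ τ)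
      nimValue-fixedSet-step = begin
        nimValue Δ              ≡⟨ nimValue-options Δ ⟩
        mex (options Δ)         ≡⟨ mex-extend fixed-option missing-value ⟩
        mex (options Δᵗ)        ≡⟨ nimValue-options Δᵗ ⟨
        nimValue Δᵗ             ∎
        where
        open ≡-Reasoning
        Δᵗ = fixedSet Δ τ
        fixed-option : ∀ {x} → x ∈ₗ options Δᵗ → x ∈ₗ options Δ
        fixed-option x∈ with σ , σ∈Δᵗ , refl ← ∈-options⁻ {Δ = Δᵗ} x∈ =
          let σ∈Δ , σ-fixed = ∈-fixedSet⁻ {Δ = Δ} σ∈Δᵗ in
          subst (_∈ₗ options Δ) (nimValue-move-fixed σ∈Δ σ-fixed) (∈-options {Δ = Δ} σ∈Δ)
        missing-value : mex (options Δᵗ) ∉ₗ options Δ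
        missing-value mex∈ with σ , σ∈Δ , mex≡ ← ∈-options⁻ {Δ = Δ} mex∈ =
          nimValue-move≢fixedSet σ∈Δ (trans (sym mex≡) (sym (nimValue-options Δᵗ)))

  nimValue-fixedSet : Invariant Δ → nimValue Δ ≡ nimValue (fixedSet Δ τ)
  nimValue-fixedSet {Δ = Δ} = go Δ (On.wellFounded size <-wellFounded Δ)
    where
    go : (Δ : Complex n) → Acc (_<_ on size) Δ → Invariant Δ → nimValue Δ ≡ nimValue (fixedSet Δ τ)
    go _ (acc smaller) I = nimValue-fixedSet-step I λ {Δ′} size< → go Δ′ (smaller size<)

  Invariant-involution : IsSimplicialComplex Δ → IsInvolution Δ τ →
                         IsSimplicialComplex (fixedSet Δ τ) → Invariant Δ
  Invariant-involution {Δ = Δ} (nonempty , face-closed) (_ , vertex-involutive , simplex-image)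
                       (_ , fixed-face-closed) = record
    { image-closed     = λ {σ} σ∈Δ →
        proj₁ (simplex-image σ (nonempty σ σ∈Δ) (λ _ → vertex-of σ∈Δ)) σ∈Δ
    ; image-involutive = λ σ∈Δ → image-image λ a∈σ → vertex-involutive _ (vertex-of σ∈Δ a∈σ)
    ; face-of-fixed    = λ {σ} {ρ} σ∈Δ ρ∈Δ ρ-fixed σ⊆ρ → proj₂ (∈-fixedSet⁻ {Δ = Δ}
        (fixed-face-closed ρ σ (∈-fixedSet⁺ {Δ = Δ} ρ∈Δ ρ-fixed) (nonempty σ σ∈Δ) σ⊆ρ))
    }
    where
    vertex-of : ∀ {σ a} → σ ∈Δ Δ → a ∈ σ → IsVertex Δ a
    vertex-of {σ} {a} σ∈Δ a∈σ = face-closed σ ⁅ a ⁆ σ∈Δ (a , x∈⁅x⁆ a)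
      λ b∈⁅a⁆ → subst (_∈ σ) (sym (x∈⁅y⁆⇒x≡y a b∈⁅a⁆)) a∈σ

theorem1 : (n : ℕ) (Δ : Complex n) (τ : Fin n → Fin n) →
    IsSimplicialComplex Δ → IsInvolution Δ τ →
    IsSimplicialComplex (fixedSet Δ τ) →
    nimValue Δ ≡ nimValue (fixedSet Δ τ)
theorem1 n Δ τ Δ-complex τ-involution Δᵗ-complex =
  nimValue-fixedSet τ (Invariant-involution τ Δ-complex τ-involution Δᵗ-complex)
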